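{- For each integer $n \ge 0$, let $p_n$ be the probability that $a(m)=0$ when $m$ is chosen uniformly at random from the integers in the interval $[0,n]$, i.e. $p_n = \#\{m \in \{0,1,\ldots,n\} : a(m)=0\}/(n+1)$. Then $\lim_{n\to\infty} p_n = 1$.
   Context: The Fibonacci numbers are defined by $F_0=0$, $F_1=1$, and $F_{n+2}=F_{n+1}+F_n$ for $n\ge 0$. Let $A(x) = \prod_{k\ge 2}(1-x^{F_k}) = (1-x)(1-x^2)(1-x^3)(1-x^5)(1-x^8)\cdots$, regarded as a formal power series with integer coefficients, and for each integer $m \ge 0$ let $a(m)$ denote the coefficient of $x^m$ in $A(x)$. Equivalently, $a(m)=r_E(m)-r_O(m)$, where $r_E(m)$ (resp. $r_O(m)$) is the number of partitions of $m$ into an even (resp. odd) number of distinct positive Fibonacci numbers; so $a(m)=0$ iff $r_E(m)=r_O(m)$. -}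

module Defs where

open import Data.Nat using (ℕ; zero; suc; _+_; _∸_; _≤?_)
open import Data.Integer using (ℤ; +_; _-_)
import Data.Integer as ℤ
open import Data.List using (List; []; _∷_; map; upTo; filter; length)
open import Data.Rational using (ℚ; _/_)
open import Relation.Nullary using (yes; no)

fib : ℕ → ℕ
fib zero = 0
fib (suc zero) = 1
fib (suc (suc n)) = fib (suc n) + fib n

-- coeff ds m = coefficient of x^m in the polynomial ∏_{d ∈ ds} (1 - x^d)
coeff : List ℕ → ℕ → ℤ
coeff [] zero = + 1
coeff [] (suc m) = + 0
coeff (d ∷ ds) m with d ≤? m
... | yes _ = coeff ds m - coeff ds (m ∸ d)
... | no _  = coeff ds m

-- a m = coefficient of x^m in A(x) = ∏_{k ≥ 2} (1 - x^{F_k}).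
-- Only factors with F_k ≤ m can affect the coefficient of x^m; since
-- F_{m+2} > m, the factors k = 2, …, m+2 suffice (the others are ≡ 1 mod x^{m+1}).
a : ℕ → ℤ
a m = coeff (map (λ i → fib (2 + i)) (upTo (suc m))) m

zeroCount : ℕ → ℕ
zeroCount n = length (filter (λ m → a m ℤ.≟ + 0) (upTo (suc n)))

p : ℕ → ℚ
p n = (+ zeroCount n) / suc n

{-# OPTIONS --safe #-}
module Submission where

-- Let P_t(x) = ∏_{i<t} (1 - x^{F_{i+2}}). Its coefficients agree with those of A below F_{t+2},
-- and P_t is palindromic up to the sign (-1)^t, of degree F_{t+3} - 2. Multiplying P_u by the
-- factors for F_{u+2}, F_{u+3} and F_{u+4} = F_{u+2} + F_{u+3} gives, for 0 ≤ r < F_{u+3},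
--   a(F_{u+4} + r) = a(r - F_{u+2}) - (-1)^u a(F_{u+1} - 2 - r)      (a = 0 on negative integers).
-- Hence the number W(t) of m < F_t with a(m) ≠ 0 satisfies W(t+5) ≤ W(t+4) + 2 W(t+1), so
-- W(t) ≤ 3 (31/20)^t, whereas F_{t+2} ≥ (32/20)^t. For F_{t+2} ≤ n < F_{t+3} the proportion of
-- m < n with a(m) ≠ 0 is at most W(t+3)/F_{t+2}, which tends to 0 geometrically.

open import Defs

module Sums where

  open import Data.Nat
  open import Data.Nat.Properties
  open import Data.Integer as ℤ using (ℤ; +_; -[1+_]; 1ℤ; +≤+)
  import Data.Integer.Properties as ℤ
  open import Data.Nat.Tactic.RingSolver using (solve-∀)
  import Data.Integer.Tactic.RingSolver as ℤ-Solver
  open import Function using (_∘_)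
  open import Relation.Binary.PropositionalEquality

  ∑< : ℕ → (ℕ → ℕ) → ℕ
  ∑< zero    f = 0
  ∑< (suc n) f = f 0 + ∑< n (f ∘ suc)

  syntax ∑< n (λ r → e) = ∑[ r < n ] e

  ∑-cong : ∀ n {f g : ℕ → ℕ} → (∀ r → r < n → f r ≡ g r) → ∑< n f ≡ ∑< n g
  ∑-cong zero    f≡g = refl
  ∑-cong (suc n) f≡g = cong₂ _+_ (f≡g 0 z<s) (∑-cong n (λ r r<n → f≡g (suc r) (s<s r<n)))

  ∑-monoʳ-≤ : ∀ n {f g : ℕ → ℕ} → (∀ r → r < n → f r ≤ g r) → ∑< n f ≤ ∑< n g
  ∑-monoʳ-≤ zero    f≤g = z≤n
  ∑-monoʳ-≤ (suc n) f≤g = +-mono-≤ (f≤g 0 z<s) (∑-monoʳ-≤ n (λ r r<n → f≤g (suc r) (s<s r<n)))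

  ∑-+ : ∀ n (f g : ℕ → ℕ) → ∑[ r < n ] (f r + g r) ≡ ∑< n f + ∑< n g
  ∑-+ zero    f g = refl
  ∑-+ (suc n) f g = trans (cong (_+_ (f 0 + g 0)) (∑-+ n (f ∘ suc) (g ∘ suc)))
                          (interchange (f 0) (g 0) (∑< n (f ∘ suc)) (∑< n (g ∘ suc)))
    where
    interchange : ∀ a b c d → a + b + (c + d) ≡ a + c + (b + d)
    interchange = solve-∀

  ∑-split : ∀ m n (f : ℕ → ℕ) → ∑< (m + n) f ≡ ∑< m f + ∑[ r < n ] f (m + r)
  ∑-split zero    n f = refl
  ∑-split (suc m) n f = trans (cong (_+_ (f 0)) (∑-split m n (f ∘ suc))) (sym (+-assoc (f 0) _ _))

  ∑-suc : ∀ n (f : ℕ → ℕ) → ∑< (suc n) f ≡ ∑< n f + f n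
  ∑-suc zero    f = +-comm (f 0) 0
  ∑-suc (suc n) f = trans (cong (_+_ (f 0)) (∑-suc n (f ∘ suc))) (sym (+-assoc (f 0) _ _))

  ∑-monoˡ-≤ : ∀ {m n} (f : ℕ → ℕ) → m ≤ n → ∑< m f ≤ ∑< n f
  ∑-monoˡ-≤ f z≤n       = z≤n
  ∑-monoˡ-≤ f (s≤s m≤n) = +-monoʳ-≤ (f 0) (∑-monoˡ-≤ (f ∘ suc) m≤n)

  ∑-indicator-≤ : ∀ n (f : ℕ → ℕ) → (∀ r → f r ≤ 1) → ∑< n f ≤ n
  ∑-indicator-≤ zero    f f≤1 = z≤n
  ∑-indicator-≤ (suc n) f f≤1 = +-mono-≤ (f≤1 0) (∑-indicator-≤ n (f ∘ suc) (f≤1 ∘ suc))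

  module _ (h : ℤ → ℕ) where

    ∑-reflect : ∀ n c → ∑[ r < n ] h (c ℤ.- + r) ≡ ∑[ r < n ] h (c ℤ.+ 1ℤ ℤ.- + n ℤ.+ + r)
    ∑-reflect zero    c = refl
    ∑-reflect (suc n) c = begin
      h (c ℤ.- + 0) + ∑[ r < n ] h (c ℤ.- + suc r)
        ≡⟨ cong₂ _+_ (cong h (ℤ.+-identityʳ c)) (∑-cong n λ r _ → cong h (shiftˡ c (+ r))) ⟩
      h c + ∑[ r < n ] h (c ℤ.- 1ℤ ℤ.- + r)
        ≡⟨ cong (_+_ (h c)) (∑-reflect n (c ℤ.- 1ℤ)) ⟩
      h c + ∑[ r < n ] h (c ℤ.- 1ℤ ℤ.+ 1ℤ ℤ.- + n ℤ.+ + r)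
        ≡⟨ +-comm (h c) _ ⟩
      ∑[ r < n ] h (c ℤ.- 1ℤ ℤ.+ 1ℤ ℤ.- + n ℤ.+ + r) + h c
        ≡⟨ cong₂ _+_ (∑-cong n λ r _ → cong h (shiftʳ c (+ n) (+ r))) (cong h (sym (top c (+ n)))) ⟩
      ∑[ r < n ] g r + g n
        ≡⟨ ∑-suc n g ⟨
      ∑< (suc n) g ∎
      where
      open ≡-Reasoning
      g : ℕ → ℕ
      g r = h (c ℤ.+ 1ℤ ℤ.- + suc n ℤ.+ + r)
      shiftˡ : ∀ c r → c ℤ.- (1ℤ ℤ.+ r) ≡ c ℤ.- 1ℤ ℤ.- r
      shiftˡ = ℤ-Solver.solve-∀
      shiftʳ : ∀ c n r → c ℤ.- 1ℤ ℤ.+ 1ℤ ℤ.- n ℤ.+ r ≡ c ℤ.+ 1ℤ ℤ.- (1ℤ ℤ.+ n) ℤ.+ r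
      shiftʳ = ℤ-Solver.solve-∀
      top : ∀ c n → c ℤ.+ 1ℤ ℤ.- (1ℤ ℤ.+ n) ℤ.+ n ≡ c
      top = ℤ-Solver.solve-∀

    ∑-window : (∀ k → h -[1+ k ] ≡ 0) → ∀ n c {m} → c ℤ.+ + n ℤ.≤ + m →
               ∑[ r < n ] h (c ℤ.+ + r) ≤ ∑[ r < m ] h (+ r)
    ∑-window h⁻≡0 zero    c             _           = z≤n
    ∑-window h⁻≡0 n       (+ j)     {m} (+≤+ j+n≤m) = begin
      ∑[ r < n ] h (+ (j + r))                  ≤⟨ m≤n+m _ (∑< j (h ∘ +_)) ⟩
      ∑< j (h ∘ +_) + ∑[ r < n ] h (+ (j + r))  ≡⟨ ∑-split j n (h ∘ +_) ⟨
      ∑< (j + n) (h ∘ +_)                       ≤⟨ ∑-monoˡ-≤ (h ∘ +_) j+n≤m ⟩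
      ∑< m (h ∘ +_)                             ∎
      where open ≤-Reasoning
    ∑-window h⁻≡0 (suc n) c@(-[1+ k ]) {m} c+n≤m = begin
      h c + ∑[ r < n ] h (c ℤ.+ + suc r)
        ≡⟨ cong₂ _+_ (h⁻≡0 k) (∑-cong n λ r _ → cong h (sym (ℤ.+-assoc c 1ℤ (+ r)))) ⟩
      ∑[ r < n ] h (c ℤ.+ 1ℤ ℤ.+ + r)
        ≤⟨ ∑-window h⁻≡0 n (c ℤ.+ 1ℤ) (subst (ℤ._≤ + m) (sym (ℤ.+-assoc c 1ℤ (+ n))) c+n≤m) ⟩
      ∑[ r < m ] h (+ r) ∎
      where open ≤-Reasoning

module Coefficients where

  open import Data.Nat as ℕ using (ℕ; zero; suc; _∸_)
  import Data.Nat.Properties as ℕ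
  open import Data.Nat.ListAction using (sum)
  open import Data.Integer
  open import Data.Integer.Properties
  open import Data.Integer.Tactic.RingSolver using (solve-∀)
  open import Data.List using (List; []; _∷_; length)
  open import Data.List.Relation.Binary.Permutation.Propositional using (_↭_; refl; prep; swap; trans)
  open import Relation.Binary.PropositionalEquality hiding (trans)
  import Relation.Binary.PropositionalEquality as ≡
  open import Relation.Nullary using (yes; no)

  coefᶻ : List ℕ → ℤ → ℤ
  coefᶻ []       (+ zero)  = 1ℤ
  coefᶻ []       (+ suc _) = 0ℤ
  coefᶻ []       -[1+ _ ]  = 0ℤ
  coefᶻ (d ∷ ds) z         = coefᶻ ds z - coefᶻ ds (z - + d)

  i<j⇒i-j<0 : ∀ {i j} → i < j → i - j < 0ℤ
  i<j⇒i-j<0 {i} {j} i<j = subst (i - j <_) (+-inverseʳ j) (+-monoˡ-< (- j) i<j)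

  coefᶻ-negative : ∀ ds {z} → z < 0ℤ → coefᶻ ds z ≡ 0ℤ
  coefᶻ-negative []       {+ _}      (+<+ ())
  coefᶻ-negative []       { -[1+ _ ]} _   = refl
  coefᶻ-negative (d ∷ ds) {z}         z<0 =
    cong₂ _-_ (coefᶻ-negative ds z<0) (coefᶻ-negative ds (≤-<-trans (i-j≤i z (+ d)) z<0))

  coefᶻ-reflect : ∀ ds z → coefᶻ ds (+ sum ds - z) ≡ -1ℤ ^ length ds * coefᶻ ds z
  coefᶻ-reflect []       (+ zero)  = refl
  coefᶻ-reflect []       (+ suc _) = refl
  coefᶻ-reflect []       -[1+ _ ]  = refl
  coefᶻ-reflect (d ∷ ds) z         = begin
    coefᶻ ds (+ d + S - z) - coefᶻ ds (+ d + S - z - + d)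
      ≡⟨ cong₂ (λ u v → coefᶻ ds u - coefᶻ ds v) (d+S-z≡S-[z-d] (+ d) S z) (d+S-z-d≡S-z (+ d) S z) ⟩
    coefᶻ ds (S - (z - + d)) - coefᶻ ds (S - z)
      ≡⟨ cong₂ _-_ (coefᶻ-reflect ds (z - + d)) (coefᶻ-reflect ds z) ⟩
    σ * coefᶻ ds (z - + d) - σ * coefᶻ ds z
      ≡⟨ σa-σb≡-σ[b-a] σ (coefᶻ ds (z - + d)) (coefᶻ ds z) ⟩
    -1ℤ * σ * (coefᶻ ds z - coefᶻ ds (z - + d)) ∎
    where
    open ≡-Reasoning
    S = + sum ds
    σ = -1ℤ ^ length ds
    d+S-z≡S-[z-d] : ∀ d S z → d + S - z ≡ S - (z - d)
    d+S-z≡S-[z-d] = solve-∀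
    d+S-z-d≡S-z : ∀ d S z → d + S - z - d ≡ S - z
    d+S-z-d≡S-z = solve-∀
    σa-σb≡-σ[b-a] : ∀ σ a b → σ * a - σ * b ≡ -1ℤ * σ * (b - a)
    σa-σb≡-σ[b-a] = solve-∀

  coefᶻ-above-degree : ∀ ds {z} → + sum ds < z → coefᶻ ds z ≡ 0ℤ
  coefᶻ-above-degree ds {z} S<z = begin
    coefᶻ ds z                                     ≡⟨ cong (coefᶻ ds) (z≡S-[S-z] (+ sum ds) z) ⟩
    coefᶻ ds (+ sum ds - (+ sum ds - z))           ≡⟨ coefᶻ-reflect ds (+ sum ds - z) ⟩
    -1ℤ ^ length ds * coefᶻ ds (+ sum ds - z)      ≡⟨ cong (-1ℤ ^ length ds *_) (coefᶻ-negative ds (i<j⇒i-j<0 S<z)) ⟩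
    -1ℤ ^ length ds * 0ℤ                           ≡⟨ *-zeroʳ (-1ℤ ^ length ds) ⟩
    0ℤ                                             ∎
    where
    open ≡-Reasoning
    z≡S-[S-z] : ∀ S z → z ≡ S - (S - z)
    z≡S-[S-z] = solve-∀

  coefᶻ-drop-∷ : ∀ d ds {z} → z < + d → coefᶻ (d ∷ ds) z ≡ coefᶻ ds z
  coefᶻ-drop-∷ d ds {z} z<d = begin
    coefᶻ ds z - coefᶻ ds (z - + d)  ≡⟨ cong (_-_ (coefᶻ ds z)) (coefᶻ-negative ds (i<j⇒i-j<0 z<d)) ⟩
    coefᶻ ds z - 0ℤ                  ≡⟨ +-identityʳ (coefᶻ ds z) ⟩
    coefᶻ ds z                       ∎
    where open ≡-Reasoning

  coefᶻ-↭ : ∀ {ds es} → ds ↭ es → ∀ z → coefᶻ ds z ≡ coefᶻ es z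
  coefᶻ-↭ refl              z = refl
  coefᶻ-↭ (prep d ds↭es)    z = cong₂ _-_ (coefᶻ-↭ ds↭es z) (coefᶻ-↭ ds↭es (z - + d))
  coefᶻ-↭ (trans p q)       z = ≡.trans (coefᶻ-↭ p z) (coefᶻ-↭ q z)
  coefᶻ-↭ {d ∷ e ∷ ds} {_ ∷ _ ∷ es} (swap .d .e ds↭es) z = begin
    (c z - c (z - + e)) - (c (z - + d) - c (z - + d - + e))
      ≡⟨ cong (λ w → (c z - c (z - + e)) - (c (z - + d) - c w)) (z-d-e≡z-e-d z (+ d) (+ e)) ⟩
    (c z - c (z - + e)) - (c (z - + d) - c (z - + e - + d))
      ≡⟨ [a-b]-[c-d]≡[a-c]-[b-d] (c z) (c (z - + e)) (c (z - + d)) (c (z - + e - + d)) ⟩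
    (c z - c (z - + d)) - (c (z - + e) - c (z - + e - + d))
      ≡⟨ cong₂ _-_ (cong₂ _-_ (c≡c′ z) (c≡c′ (z - + d))) (cong₂ _-_ (c≡c′ (z - + e)) (c≡c′ (z - + e - + d))) ⟩
    (c′ z - c′ (z - + d)) - (c′ (z - + e) - c′ (z - + e - + d)) ∎
    where
    open ≡-Reasoning
    c  = coefᶻ ds
    c′ = coefᶻ es
    c≡c′ = coefᶻ-↭ ds↭es
    z-d-e≡z-e-d : ∀ z d e → z - d - e ≡ z - e - d
    z-d-e≡z-e-d = solve-∀
    [a-b]-[c-d]≡[a-c]-[b-d] : ∀ a b c d → (a - b) - (c - d) ≡ (a - c) - (b - d)
    [a-b]-[c-d]≡[a-c]-[b-d] = solve-∀

  coeff≡coefᶻ : ∀ ds m → coeff ds m ≡ coefᶻ ds (+ m)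
  coeff≡coefᶻ []       zero    = refl
  coeff≡coefᶻ []       (suc m) = refl
  coeff≡coefᶻ (d ∷ ds) m with d ℕ.≤? m
  ... | yes d≤m = cong₂ _-_ (coeff≡coefᶻ ds m) (≡.trans (coeff≡coefᶻ ds (m ∸ d)) (cong (coefᶻ ds) +[m∸d]≡m-d))
    where
    +[m∸d]≡m-d : + (m ∸ d) ≡ + m - + d
    +[m∸d]≡m-d = ≡.trans (sym (⊖-≥ d≤m)) (sym (m-n≡m⊖n m d))
  ... | no d≰m = ≡.trans (coeff≡coefᶻ ds m) (sym (coefᶻ-drop-∷ d ds (+<+ (ℕ.≰⇒> d≰m))))

  coefᶻ-triple : ∀ L x y r → sum L ℕ.< y → r ℕ.< y →
                 coefᶻ (y ℕ.+ x ∷ y ∷ x ∷ L) (+ y + + x + + r) ≡ coefᶻ L (+ r - + x) - coefᶻ L (+ x + + r)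
  coefᶻ-triple L x y r S<y r<y = begin
    C₂ N - C₂ (N - (+ y + + x))
      ≡⟨ cong (λ w → C₂ N - C₂ w) (y+x+r-[y+x]≡r (+ y) (+ x) (+ r)) ⟩
    (C₁ N - C₁ (N - + y)) - (C₁ (+ r) - C₁ (+ r - + y))
      ≡⟨ cong₂ (λ u v → (u - C₁ (N - + y)) - (C₁ (+ r) - v)) C₁N≡0 (coefᶻ-negative (x ∷ L) (i<j⇒i-j<0 (+<+ r<y))) ⟩
    (0ℤ - C₁ (N - + y)) - (C₁ (+ r) - 0ℤ)
      ≡⟨ cong (λ w → (0ℤ - C₁ w) - (C₁ (+ r) - 0ℤ)) (y+x+r-y≡x+r (+ y) (+ x) (+ r)) ⟩
    (0ℤ - (c (+ x + + r) - c (+ x + + r - + x))) - ((c (+ r) - c (+ r - + x)) - 0ℤ)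
      ≡⟨ cong (λ w → (0ℤ - (c (+ x + + r) - c w)) - ((c (+ r) - c (+ r - + x)) - 0ℤ)) (x+r-x≡r (+ x) (+ r)) ⟩
    (0ℤ - (c (+ x + + r) - c (+ r))) - ((c (+ r) - c (+ r - + x)) - 0ℤ)
      ≡⟨ telescope (c (+ x + + r)) (c (+ r)) (c (+ r - + x)) ⟩
    c (+ r - + x) - c (+ x + + r) ∎
    where
    open ≡-Reasoning
    c  = coefᶻ L
    C₁ = coefᶻ (x ∷ L)
    C₂ = coefᶻ (y ∷ x ∷ L)
    N  = + y + + x + + r
    C₁N≡0 : C₁ N ≡ 0ℤ
    C₁N≡0 = coefᶻ-above-degree (x ∷ L) (+<+ (ℕ.<-≤-trans (ℕ.+-monoʳ-< x S<y)
      (ℕ.≤-trans (ℕ.≤-reflexive (ℕ.+-comm x y)) (ℕ.m≤m+n (y ℕ.+ x) r))))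
    y+x+r-[y+x]≡r : ∀ y x r → y + x + r - (y + x) ≡ r
    y+x+r-[y+x]≡r = solve-∀
    y+x+r-y≡x+r : ∀ y x r → y + x + r - y ≡ x + r
    y+x+r-y≡x+r = solve-∀
    x+r-x≡r : ∀ x r → x + r - x ≡ r
    x+r-x≡r = solve-∀
    telescope : ∀ a b e → (0ℤ - (a - b)) - ((b - e) - 0ℤ) ≡ e - a
    telescope = solve-∀

module Fibonacci where

  open import Data.Nat
  open import Data.Nat.Properties
  open import Data.Nat.Tactic.RingSolver using (solve-∀)
  open import Relation.Binary.PropositionalEquality

  fib-≤-suc : ∀ n → fib n ≤ fib (suc n)
  fib-≤-suc zero    = z≤n
  fib-≤-suc (suc n) = m≤m+n (fib (suc n)) (fib n)

  fib-mono-≤ : ∀ {m n} → m ≤ n → fib m ≤ fib n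
  fib-mono-≤ m≤n = mono (≤⇒≤′ m≤n)
    where
    mono : ∀ {m n} → m ≤′ n → fib m ≤ fib n
    mono ≤′-refl                    = ≤-refl
    mono {n = suc n} (≤′-step m≤′n) = ≤-trans (mono m≤′n) (fib-≤-suc n)

  n<fib[2+n] : ∀ n → n < fib (2 + n)
  n<fib[2+n] zero          = z<s
  n<fib[2+n] (suc zero)    = s<s z<s
  n<fib[2+n] (suc (suc n)) = subst (_≤ fib (4 + n)) (+-comm (2 + n) 1)
    (+-mono-≤ (n<fib[2+n] (suc n)) (≤-trans (s≤s z≤n) (n<fib[2+n] n)))

  fib-lower-bound : ∀ {p q} → p ≤ 2 * q → p * p ≤ p * q + q * q → ∀ t → p ^ t ≤ fib (2 + t) * q ^ t
  fib-lower-bound               p≤2q p²≤pq+q² zero          = ≤-refl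
  fib-lower-bound {p} {q}       p≤2q p²≤pq+q² (suc zero)    = begin
    p * 1        ≡⟨ *-identityʳ p ⟩
    p            ≤⟨ p≤2q ⟩
    2 * q        ≡⟨ cong (2 *_) (*-identityʳ q) ⟨
    2 * (q * 1)  ∎
    where open ≤-Reasoning
  fib-lower-bound {p} {q} p≤2q p²≤pq+q² (suc (suc t)) = begin
    p * (p * p ^ t)                                    ≡⟨ *-assoc p p (p ^ t) ⟨
    p * p * p ^ t                                      ≤⟨ *-monoˡ-≤ (p ^ t) p²≤pq+q² ⟩
    (p * q + q * q) * p ^ t                            ≡⟨ regroup p q (p ^ t) ⟩
    q * (p * p ^ t) + q * q * p ^ t                    ≤⟨ +-mono-≤ (*-monoʳ-≤ q (fib-lower-bound p≤2q p²≤pq+q² (suc t)))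
                                                                   (*-monoʳ-≤ (q * q) (fib-lower-bound p≤2q p²≤pq+q² t)) ⟩
    q * (F₃ * (q * q ^ t)) + q * q * (F₂ * q ^ t)      ≡⟨ collect F₃ F₂ q (q ^ t) ⟩
    (F₃ + F₂) * (q * (q * q ^ t))                      ∎
    where
    open ≤-Reasoning
    F₃ = fib (3 + t)
    F₂ = fib (2 + t)
    regroup : ∀ p q P → (p * q + q * q) * P ≡ q * (p * P) + q * q * P
    regroup = solve-∀
    collect : ∀ a b q Q → q * (a * (q * Q)) + q * q * (b * Q) ≡ (a + b) * (q * (q * Q))
    collect = solve-∀

module Growth where

  open import Data.Nat
  open import Data.Nat.Properties
  open import Data.Nat.Tactic.RingSolver using (solve-∀)
  open import Relation.Binary.PropositionalEquality

  recurrence-bound : ∀ (w : ℕ → ℕ) {c p q} → q ≤ p → q * p ^ 3 + 2 * q ^ 4 ≤ p ^ 4 →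
                     (∀ t → t ≤ 4 → w t ≤ c) → (∀ t → w (5 + t) ≤ w (4 + t) + 2 * w (1 + t)) →
                     ∀ t → w t * q ^ t ≤ c * p ^ t
  recurrence-bound w {c} {p} {q} q≤p qp³+2q⁴≤p⁴ w≤c w-rec = bound
    where
    initial : ∀ t → t ≤ 4 → w t * q ^ t ≤ c * p ^ t
    initial t t≤4 = *-mono-≤ (w≤c t t≤4) (^-monoˡ-≤ t q≤p)

    step : ∀ t → w (4 + t) * q ^ (4 + t) ≤ c * p ^ (4 + t) → w (1 + t) * q ^ (1 + t) ≤ c * p ^ (1 + t) →
           w (5 + t) * q ^ (5 + t) ≤ c * p ^ (5 + t)
    step t bound₄ bound₁ = begin
      w (5 + t) * q ^ (5 + t)                                                ≤⟨ *-monoˡ-≤ (q ^ (5 + t)) (w-rec t) ⟩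
      (w (4 + t) + 2 * w (1 + t)) * q ^ (5 + t)                              ≡⟨ expand (w (4 + t)) (w (1 + t)) q (q ^ (1 + t)) ⟩
      q * (w (4 + t) * q ^ (4 + t)) + 2 * q ^ 4 * (w (1 + t) * q ^ (1 + t))  ≤⟨ +-mono-≤ (*-monoʳ-≤ q bound₄) (*-monoʳ-≤ (2 * q ^ 4) bound₁) ⟩
      q * (c * p ^ (4 + t)) + 2 * q ^ 4 * (c * p ^ (1 + t))                  ≡⟨ factor c p q (p ^ (1 + t)) ⟩
      c * p ^ (1 + t) * (q * p ^ 3 + 2 * q ^ 4)                              ≤⟨ *-monoʳ-≤ (c * p ^ (1 + t)) qp³+2q⁴≤p⁴ ⟩
      c * p ^ (1 + t) * p ^ 4                                                ≡⟨ collect c p (p ^ (1 + t)) ⟩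
      c * p ^ (5 + t)                                                        ∎
      where
      open ≤-Reasoning
      -- Powers are written out because the ring solver does not normalise _^_.
      expand : ∀ w₄ w₁ q Q → (w₄ + 2 * w₁) * (q * (q * (q * (q * Q))))
                           ≡ q * (w₄ * (q * (q * (q * Q)))) + 2 * (q * (q * (q * (q * 1)))) * (w₁ * Q)
      expand = solve-∀
      factor : ∀ c p q P → q * (c * (p * (p * (p * P)))) + 2 * (q * (q * (q * (q * 1)))) * (c * P)
                         ≡ c * P * (q * (p * (p * (p * 1))) + 2 * (q * (q * (q * (q * 1)))))
      factor = solve-∀
      collect : ∀ c p P → c * P * (p * (p * (p * (p * 1)))) ≡ c * (p * (p * (p * (p * P))))
      collect = solve-∀

    bound : ∀ t → w t * q ^ t ≤ c * p ^ t
    bound 0 = initial 0 z≤n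
    bound 1 = initial 1 (s≤s z≤n)
    bound 2 = initial 2 (s≤s (s≤s z≤n))
    bound 3 = initial 3 (s≤s (s≤s (s≤s z≤n)))
    bound 4 = initial 4 ≤-refl
    bound (suc t₄@(suc (suc (suc (suc t))))) = step t (bound t₄) (bound (suc t))

  bernoulli : ∀ b t → b ^ t * (b + t) ≤ b * suc b ^ t
  bernoulli b zero    = ≤-reflexive (1*[b+0]≡b*1 b)
    where
    1*[b+0]≡b*1 : ∀ b → 1 * (b + 0) ≡ b * 1
    1*[b+0]≡b*1 = solve-∀
  bernoulli b (suc t) = begin
    b * B * (b + (1 + t))          ≡⟨ expand b B t ⟩
    B * (b * (1 + b) + b * t)      ≤⟨ *-monoʳ-≤ B (+-monoʳ-≤ (b * (1 + b)) (*-monoˡ-≤ t (n≤1+n b))) ⟩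
    B * (b * (1 + b) + (1 + b) * t) ≡⟨ factor b B t ⟩
    (1 + b) * (B * (b + t))        ≤⟨ *-monoʳ-≤ (1 + b) (bernoulli b t) ⟩
    (1 + b) * (b * C)              ≡⟨ swap b C ⟩
    b * ((1 + b) * C)              ∎
    where
    open ≤-Reasoning
    B = b ^ t
    C = suc b ^ t
    expand : ∀ b B t → b * B * (b + (1 + t)) ≡ B * (b * (1 + b) + b * t)
    expand = solve-∀
    factor : ∀ b B t → B * (b * (1 + b) + (1 + b) * t) ≡ (1 + b) * (B * (b + t))
    factor = solve-∀
    swap : ∀ b C → (1 + b) * (b * C) ≡ b * ((1 + b) * C)
    swap = solve-∀

  ^-dominates : ∀ b .{{_ : NonZero b}} {K t} → b * K ≤ t → K * b ^ t < suc b ^ t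
  ^-dominates b {K} {t} bK≤t = begin-strict
    K * b ^ t        <⟨ *-monoˡ-< (b ^ t) {{m^n≢0 b t}} (n<1+n K) ⟩
    suc K * b ^ t    ≤⟨ *-cancelˡ-≤ b (begin
      b * (suc K * b ^ t)    ≡⟨ regroup b K (b ^ t) ⟩
      b ^ t * (b + b * K)    ≤⟨ *-monoʳ-≤ (b ^ t) (+-monoʳ-≤ b bK≤t) ⟩
      b ^ t * (b + t)        ≤⟨ bernoulli b t ⟩
      b * suc b ^ t          ∎) ⟩
    suc b ^ t        ∎
    where
    open ≤-Reasoning
    regroup : ∀ b K P → b * ((1 + K) * P) ≡ P * (b + b * K)
    regroup = solve-∀

module Recurrence where

  open Coefficients
  open Fibonacci
  open import Data.Nat as ℕ using (ℕ; zero; suc)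
  import Data.Nat.Properties as ℕ
  open import Data.Nat.ListAction using (sum)
  open import Data.Integer hiding (suc)
  open import Data.Integer.Properties
  open import Data.Integer.Tactic.RingSolver using (solve-∀)
  open import Data.List using (List; _∷_; length; map; upTo; applyUpTo; applyDownFrom)
  open import Data.List.Properties using (map-upTo; reverse-applyUpTo; length-applyDownFrom)
  open import Data.List.Relation.Binary.Permutation.Propositional using (_↭_; ↭-sym)
  open import Data.List.Relation.Binary.Permutation.Propositional.Properties using (↭-reverse)
  open import Relation.Binary.PropositionalEquality

  -- The exponents of P_t, largest first, so that the factors of P_{k+t} beyond P_t come first.
  fibs : ℕ → List ℕ
  fibs = applyDownFrom (λ i → fib (2 ℕ.+ i))

  sum-fibs : ∀ t → sum (fibs t) ℕ.+ 2 ≡ fib (3 ℕ.+ t)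
  sum-fibs zero    = refl
  sum-fibs (suc t) = begin
    fib (2 ℕ.+ t) ℕ.+ sum (fibs t) ℕ.+ 2    ≡⟨ ℕ.+-assoc (fib (2 ℕ.+ t)) _ 2 ⟩
    fib (2 ℕ.+ t) ℕ.+ (sum (fibs t) ℕ.+ 2)  ≡⟨ cong (fib (2 ℕ.+ t) ℕ.+_) (sum-fibs t) ⟩
    fib (2 ℕ.+ t) ℕ.+ fib (3 ℕ.+ t)         ≡⟨ ℕ.+-comm (fib (2 ℕ.+ t)) _ ⟩
    fib (4 ℕ.+ t)                            ∎
    where open ≡-Reasoning

  upTo↭fibs : ∀ n → map (λ i → fib (2 ℕ.+ i)) (upTo n) ↭ fibs n
  upTo↭fibs n = subst₂ _↭_ (sym (map-upTo G n)) (reverse-applyUpTo G n) (↭-sym (↭-reverse (applyUpTo G n)))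
    where
    G : ℕ → ℕ
    G i = fib (2 ℕ.+ i)

  a≡coefᶻ-fibs : ∀ m → a m ≡ coefᶻ (fibs (suc m)) (+ m)
  a≡coefᶻ-fibs m = trans (coeff≡coefᶻ (map (λ i → fib (2 ℕ.+ i)) (upTo (suc m))) m)
                         (coefᶻ-↭ (upTo↭fibs (suc m)) (+ m))

  coefᶻ-fibs-stable : ∀ k t {z} → z < + fib (2 ℕ.+ t) → coefᶻ (fibs (k ℕ.+ t)) z ≡ coefᶻ (fibs t) z
  coefᶻ-fibs-stable zero    t z<F = refl
  coefᶻ-fibs-stable (suc k) t z<F = trans
    (coefᶻ-drop-∷ _ (fibs (k ℕ.+ t)) (<-≤-trans z<F (+≤+ (fib-mono-≤ (ℕ.+-monoʳ-≤ 2 (ℕ.m≤n+m t k))))))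
    (coefᶻ-fibs-stable k t z<F)

  aᶻ : ℤ → ℤ
  aᶻ (+ m)    = a m
  aᶻ -[1+ _ ] = 0ℤ

  aᶻ≡coefᶻ-fibs : ∀ t {z} → z < + fib (2 ℕ.+ t) → aᶻ z ≡ coefᶻ (fibs t) z
  aᶻ≡coefᶻ-fibs t { -[1+ _ ]} _   = sym (coefᶻ-negative (fibs t) -<+)
  aᶻ≡coefᶻ-fibs t {+ m}       m<F = begin
    a m                                   ≡⟨ a≡coefᶻ-fibs m ⟩
    coefᶻ (fibs (suc m)) (+ m)            ≡⟨ coefᶻ-fibs-stable t (suc m) (+<+ (ℕ.<-≤-trans (n<fib[2+n] m) (fib-≤-suc (2 ℕ.+ m)))) ⟨
    coefᶻ (fibs (t ℕ.+ suc m)) (+ m)      ≡⟨ cong (λ n → coefᶻ (fibs n) (+ m)) (ℕ.+-comm t (suc m)) ⟩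
    coefᶻ (fibs (suc m ℕ.+ t)) (+ m)      ≡⟨ coefᶻ-fibs-stable (suc m) t m<F ⟩
    coefᶻ (fibs t) (+ m)                  ∎
    where open ≡-Reasoning

  aᶻ-recurrence : ∀ u r → r ℕ.< fib (3 ℕ.+ u) →
    aᶻ (+ fib (4 ℕ.+ u) + + r) ≡ aᶻ (+ r - + fib (2 ℕ.+ u)) - -1ℤ ^ u * aᶻ (+ fib (1 ℕ.+ u) - + 2 - + r)
  aᶻ-recurrence u r r<F₃ = begin-equality
    aᶻ (+ F₄ + + r)
      ≡⟨ aᶻ≡coefᶻ-fibs (3 ℕ.+ u) (+<+ (ℕ.+-monoʳ-< F₄ r<F₃)) ⟩
    coefᶻ (F₃ ℕ.+ F₂ ∷ F₃ ∷ F₂ ∷ fibs u) (+ F₃ + + F₂ + + r)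
      ≡⟨ coefᶻ-triple (fibs u) F₂ F₃ r S<F₃ r<F₃ ⟩
    coefᶻ (fibs u) (+ r - + F₂) - coefᶻ (fibs u) (+ F₂ + + r)
      ≡⟨ cong₂ _-_ (sym (aᶻ≡coefᶻ-fibs u r-F₂<F₂)) reflected ⟩
    aᶻ (+ r - + F₂) - -1ℤ ^ u * aᶻ w ∎
    where
    open ≤-Reasoning
    F₁ = fib (1 ℕ.+ u)
    F₂ = fib (2 ℕ.+ u)
    F₃ = fib (3 ℕ.+ u)
    F₄ = fib (4 ℕ.+ u)
    S  = sum (fibs u)
    w  = + F₁ - + 2 - + r

    S<F₃ : S ℕ.< F₃
    S<F₃ = subst (S ℕ.<_) (sum-fibs u) (ℕ.m<m+n S ℕ.z<s)

    r-F₂<F₂ : + r - + F₂ < + F₂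
    r-F₂<F₂ = begin-strict
      + r - + F₂    <⟨ +-monoˡ-< (- + F₂) (+<+ r<F₃) ⟩
      + F₃ - + F₂   ≡⟨ x+y-x≡y (+ F₂) (+ F₁) ⟩
      + F₁          ≤⟨ +≤+ (fib-≤-suc (1 ℕ.+ u)) ⟩
      + F₂          ∎
      where
      x+y-x≡y : ∀ x y → x + y - x ≡ y
      x+y-x≡y = solve-∀

    w<F₂ : w < + F₂
    w<F₂ = begin-strict
      + F₁ - + 2 - + r  ≤⟨ i-j≤i (+ F₁ - + 2) (+ r) ⟩
      + F₁ - + 2        <⟨ +-monoʳ-< (+ F₁) -<+ ⟩
      + F₁ + 0ℤ         ≡⟨ +-identityʳ (+ F₁) ⟩
      + F₁              ≤⟨ +≤+ (fib-≤-suc (1 ℕ.+ u)) ⟩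
      + F₂              ∎

    F₂+r≡S-w : + F₂ + + r ≡ + S - w
    F₂+r≡S-w = begin-equality
      + F₂ + + r                     ≡⟨ x+r≡[x+y-c]-[y-c-r] (+ F₂) (+ F₁) (+ 2) (+ r) ⟩
      + F₃ - + 2 - w                 ≡⟨ cong (λ v → + v - + 2 - w) (sum-fibs u) ⟨
      + S + + 2 - + 2 - w            ≡⟨ s+c-c-w≡s-w (+ S) (+ 2) w ⟩
      + S - w                        ∎
      where
      x+r≡[x+y-c]-[y-c-r] : ∀ x y c r → x + r ≡ x + y - c - (y - c - r)
      x+r≡[x+y-c]-[y-c-r] = solve-∀
      s+c-c-w≡s-w : ∀ s c w → s + c - c - w ≡ s - w
      s+c-c-w≡s-w = solve-∀

    reflected : coefᶻ (fibs u) (+ F₂ + + r) ≡ -1ℤ ^ u * aᶻ w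
    reflected = begin-equality
      coefᶻ (fibs u) (+ F₂ + + r)                ≡⟨ cong (coefᶻ (fibs u)) F₂+r≡S-w ⟩
      coefᶻ (fibs u) (+ S - w)                   ≡⟨ coefᶻ-reflect (fibs u) w ⟩
      -1ℤ ^ length (fibs u) * coefᶻ (fibs u) w   ≡⟨ cong₂ (λ n c → -1ℤ ^ n * c) (length-applyDownFrom _ u)
                                                                                  (sym (aᶻ≡coefᶻ-fibs u w<F₂)) ⟩
      -1ℤ ^ u * aᶻ w                             ∎

module Counting where

  open Sums
  open Fibonacci
  open Growth
  open Recurrence using (aᶻ; aᶻ-recurrence)
  open import Data.Nat
  open import Data.Nat.Properties
  open import Data.Integer as ℤ using (ℤ; +_; 0ℤ; 1ℤ)
  import Data.Integer.Properties as ℤ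
  import Data.Integer.Tactic.RingSolver as ℤ-Solver
  open import Data.Nat.Tactic.RingSolver using (solve-∀)
  open import Data.List using (length; filter; applyUpTo)
  open import Data.Product using (∃-syntax; _×_; _,_)
  open import Function using (_∘_)
  open import Relation.Binary.PropositionalEquality
  open import Relation.Nullary using (yes; no; contradiction)

  nonzero : ℤ → ℕ
  nonzero x with x ℤ.≟ 0ℤ
  ... | yes _ = 0
  ... | no  _ = 1

  nonzero-≤-1 : ∀ x → nonzero x ≤ 1
  nonzero-≤-1 x with x ℤ.≟ 0ℤ
  ... | yes _ = z≤n
  ... | no  _ = ≤-refl

  nonzero-sub : ∀ x s y → nonzero (x ℤ.- s ℤ.* y) ≤ nonzero x + nonzero y
  nonzero-sub x s y with x ℤ.≟ 0ℤ | y ℤ.≟ 0ℤ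
  ... | no _     | _        = ≤-trans (nonzero-≤-1 _) (s≤s z≤n)
  ... | yes _    | no _     = ≤-trans (nonzero-≤-1 _) ≤-refl
  ... | yes refl | yes refl = ≤-reflexive (cong nonzero (0-s*0≡0 s))
    where
    0-s*0≡0 : ∀ s → 0ℤ ℤ.- s ℤ.* 0ℤ ≡ 0ℤ
    0-s*0≡0 = ℤ-Solver.solve-∀

  zeros+nonzeros : ∀ (g : ℕ → ℤ) f n →
                   length (filter (λ m → g m ℤ.≟ 0ℤ) (applyUpTo f n)) + ∑[ i < n ] nonzero (g (f i)) ≡ n
  zeros+nonzeros g f zero = refl
  zeros+nonzeros g f (suc n) with g (f 0) ℤ.≟ 0ℤ
  ... | yes _ = cong suc (zeros+nonzeros g (f ∘ suc) n)
  ... | no  _ = trans (+-suc _ _) (cong suc (zeros+nonzeros g (f ∘ suc) n))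

  nonzeros : ℕ → ℕ
  nonzeros n = ∑[ m < n ] nonzero (a m)

  nonzeros-≤ : ∀ n → nonzeros n ≤ n
  nonzeros-≤ n = ∑-indicator-≤ n (nonzero ∘ a) (nonzero-≤-1 ∘ a)

  nonzeros-fib-recurrence : ∀ u → nonzeros (fib (5 + u)) ≤ nonzeros (fib (4 + u)) + 2 * nonzeros (fib (1 + u))
  nonzeros-fib-recurrence u = begin
    nonzeros (F₄ + F₃)                                                   ≡⟨ ∑-split F₄ F₃ (nonzero ∘ a) ⟩
    nonzeros F₄ + ∑[ r < F₃ ] h (+ F₄ ℤ.+ + r)                           ≤⟨ +-monoʳ-≤ (nonzeros F₄) (∑-monoʳ-≤ F₃ pointwise) ⟩
    nonzeros F₄ + ∑[ r < F₃ ] (h (ℤ.- + F₂ ℤ.+ + r) + h (c ℤ.- + r))    ≡⟨ cong (_+_ (nonzeros F₄)) (∑-+ F₃ _ _) ⟩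
    nonzeros F₄ + (∑[ r < F₃ ] h (ℤ.- + F₂ ℤ.+ + r) + ∑[ r < F₃ ] h (c ℤ.- + r))
                                                                         ≤⟨ +-monoʳ-≤ (nonzeros F₄) (+-mono-≤ shifted reflected) ⟩
    nonzeros F₄ + (nonzeros F₁ + nonzeros F₁)                            ≡⟨ cong (λ s → nonzeros F₄ + (nonzeros F₁ + s))
                                                                                 (+-identityʳ (nonzeros F₁)) ⟨
    nonzeros F₄ + 2 * nonzeros F₁                                        ∎
    where
    open ≤-Reasoning
    F₁ = fib (1 + u)
    F₂ = fib (2 + u)
    F₃ = fib (3 + u)
    F₄ = fib (4 + u)
    c  = + F₁ ℤ.- + 2
    h : ℤ → ℕ
    h = nonzero ∘ aᶻ

    pointwise : ∀ r → r < F₃ → h (+ F₄ ℤ.+ + r) ≤ h (ℤ.- + F₂ ℤ.+ + r) + h (c ℤ.- + r)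
    pointwise r r<F₃ = begin
      h (+ F₄ ℤ.+ + r)                                                ≡⟨ cong nonzero (aᶻ-recurrence u r r<F₃) ⟩
      nonzero (aᶻ (+ r ℤ.- + F₂) ℤ.- ℤ.-1ℤ ℤ.^ u ℤ.* aᶻ (c ℤ.- + r))  ≤⟨ nonzero-sub (aᶻ (+ r ℤ.- + F₂)) (ℤ.-1ℤ ℤ.^ u) _ ⟩
      h (+ r ℤ.- + F₂) + h (c ℤ.- + r)                                ≡⟨ cong (λ z → h z + h (c ℤ.- + r))
                                                                              (ℤ.+-comm (+ r) (ℤ.- + F₂)) ⟩
      h (ℤ.- + F₂ ℤ.+ + r) + h (c ℤ.- + r)                            ∎

    shifted : ∑[ r < F₃ ] h (ℤ.- + F₂ ℤ.+ + r) ≤ nonzeros F₁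
    shifted = ∑-window h (λ _ → refl) F₃ (ℤ.- + F₂) (ℤ.≤-reflexive (-x+[x+y]≡y (+ F₂) (+ F₁)))
      where
      -x+[x+y]≡y : ∀ x y → ℤ.- x ℤ.+ (x ℤ.+ y) ≡ y
      -x+[x+y]≡y = ℤ-Solver.solve-∀

    reflected : ∑[ r < F₃ ] h (c ℤ.- + r) ≤ nonzeros F₁
    reflected = begin
      ∑[ r < F₃ ] h (c ℤ.- + r)                         ≡⟨ ∑-reflect h F₃ c ⟩
      ∑[ r < F₃ ] h (c ℤ.+ 1ℤ ℤ.- + F₃ ℤ.+ + r)         ≤⟨ ∑-window h (λ _ → refl) F₃ (c ℤ.+ 1ℤ ℤ.- + F₃) top≤F₁ ⟩
      nonzeros F₁                                       ∎
      where
      y-2+1-z+z≡y-1 : ∀ y z → y ℤ.- + 2 ℤ.+ 1ℤ ℤ.- z ℤ.+ z ≡ y ℤ.- 1ℤ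
      y-2+1-z+z≡y-1 = ℤ-Solver.solve-∀
      top≤F₁ : c ℤ.+ 1ℤ ℤ.- + F₃ ℤ.+ + F₃ ℤ.≤ + F₁
      top≤F₁ = ℤ.≤-trans (ℤ.≤-reflexive (y-2+1-z+z≡y-1 (+ F₁) (+ F₃))) (ℤ.i-j≤i (+ F₁) 1ℤ)

  nonzeros-fib-bound : ∀ t → nonzeros (fib t) * 20 ^ t ≤ 3 * 31 ^ t
  nonzeros-fib-bound = recurrence-bound (nonzeros ∘ fib) (≤ᵇ⇒≤ 20 31 _) (≤ᵇ⇒≤ _ _ _)
    (λ t t≤4 → ≤-trans (nonzeros-≤ (fib t)) (fib-mono-≤ t≤4)) nonzeros-fib-recurrence

  nonzeros-fib-sparse : ∀ d → ∃[ T ] ∀ t → T ≤ t → d * nonzeros (fib (3 + t)) < fib (2 + t)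
  nonzeros-fib-sparse d = 31 * K , λ t T≤t → *-cancelʳ-< (20 ^ (3 + t)) _ _ (begin-strict
    d * W t * 20 ^ (3 + t)          ≡⟨ *-assoc d (W t) _ ⟩
    d * (W t * 20 ^ (3 + t))        ≤⟨ *-monoʳ-≤ d (nonzeros-fib-bound (3 + t)) ⟩
    d * (3 * 31 ^ (3 + t))          ≡⟨ regroup d (31 ^ t) ⟩
    K * 31 ^ t                      <⟨ ^-dominates 31 {K} T≤t ⟩
    32 ^ t                          ≤⟨ fib-lower-bound (≤ᵇ⇒≤ 32 40 _) (≤ᵇ⇒≤ _ _ _) t ⟩
    fib (2 + t) * 20 ^ t            ≤⟨ *-monoʳ-≤ (fib (2 + t)) (^-monoʳ-≤ 20 (m≤n+m t 3)) ⟩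
    fib (2 + t) * 20 ^ (3 + t)      ∎)
    where
    open ≤-Reasoning
    K = d * (3 * 31 ^ 3)
    W : ℕ → ℕ
    W t = nonzeros (fib (3 + t))
    regroup : ∀ d P → d * (3 * (31 * (31 * (31 * P)))) ≡ d * (3 * (31 * (31 * (31 * 1)))) * P
    regroup = solve-∀

  bracket : ∀ (f : ℕ → ℕ) k {T m} → f T ≤ m → m < f (k + T) → ∃[ t ] T ≤ t × f t ≤ m × m < f (suc t)
  bracket f zero    fT≤m m<fT = contradiction fT≤m (<⇒≱ m<fT)
  bracket f (suc k) {T} {m} fT≤m m<f[1+k+T] with m <? f (k + T)
  ... | yes m<f[k+T] = bracket f k fT≤m m<f[k+T]
  ... | no  m≮f[k+T] = k + T , m≤n+m T k , ≮⇒≥ m≮f[k+T] , m<f[1+k+T]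

  nonzeros-sparse : ∀ d → ∃[ N ] ∀ n → N ≤ n → d * nonzeros n < n
  nonzeros-sparse d =
    let T , sparse = nonzeros-fib-sparse d in
    fib (2 + T) , λ n F≤n →
    let t , T≤t , F₂≤n , n<F₃ = bracket (λ t → fib (2 + t)) n F≤n (n<fib[2+n+T] n T) in
    begin-strict
      d * nonzeros n                ≤⟨ *-monoʳ-≤ d (∑-monoˡ-≤ (nonzero ∘ a) (<⇒≤ n<F₃)) ⟩
      d * nonzeros (fib (3 + t))    <⟨ sparse t T≤t ⟩
      fib (2 + t)                   ≤⟨ F₂≤n ⟩
      n                             ∎
    where
    open ≤-Reasoning
    n<fib[2+n+T] : ∀ n T → n < fib (2 + (n + T))
    n<fib[2+n+T] n T = <-≤-trans (n<fib[2+n] n) (fib-mono-≤ (+-monoʳ-≤ 2 (m≤m+n n T)))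

module Density where

  open Counting using (nonzeros; zeros+nonzeros)
  open import Data.Nat as ℕ using (suc)
  open import Data.Integer as ℤ using (+_; 0ℤ; 1ℤ)
  import Data.Integer.Properties as ℤ
  open import Data.Integer.Tactic.RingSolver using (solve-∀)
  open import Data.Rational using (mkℚ; 0ℚ; 1ℚ; _<_; _-_; -_; ∣_∣; _/_; ↧ₙ_; toℚᵘ; *<*)
  open import Data.Rational.Properties
  import Data.Rational.Unnormalised as ℚᵘ
  import Data.Rational.Unnormalised.Properties as ℚᵘ
  open import Relation.Binary.PropositionalEquality

  zeroCount+nonzeros : ∀ n → zeroCount n ℕ.+ nonzeros (suc n) ≡ suc n
  zeroCount+nonzeros n = zeros+nonzeros a (λ i → i) (suc n)

  toℚᵘ-/ : ∀ i n → toℚᵘ (i / suc n) ℚᵘ.≃ ℚᵘ.mkℚᵘ i n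
  toℚᵘ-/ i n = toℚᵘ-fromℚᵘ (ℚᵘ.mkℚᵘ i n)

  z/s-1≡-w/s : ∀ {z w n} → z ℕ.+ w ≡ suc n → + z / suc n - 1ℚ ≡ - (+ w / suc n)
  z/s-1≡-w/s {z} {w} {n} z+w≡s = toℚᵘ-injective (begin
    toℚᵘ (+ z / s - 1ℚ)                      ≈⟨ toℚᵘ-homo-+ (+ z / s) (- 1ℚ) ⟩
    toℚᵘ (+ z / s) ℚᵘ.+ toℚᵘ (- 1ℚ)          ≈⟨ ℚᵘ.+-congˡ (toℚᵘ (- 1ℚ)) (toℚᵘ-/ (+ z) n) ⟩
    ℚᵘ.mkℚᵘ (+ z) n ℚᵘ.+ toℚᵘ (- 1ℚ)         ≈⟨ ℚᵘ.*≡* cross-multiply ⟩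
    ℚᵘ.- ℚᵘ.mkℚᵘ (+ w) n                     ≈⟨ ℚᵘ.-‿cong (toℚᵘ-/ (+ w) n) ⟨
    ℚᵘ.- toℚᵘ (+ w / s)                      ≈⟨ toℚᵘ-homo‿- (+ w / s) ⟨
    toℚᵘ (- (+ w / s))                       ∎)
    where
    open ℚᵘ.≃-Reasoning
    s = suc n
    cross-multiply : (+ z ℤ.* 1ℤ ℤ.+ ℤ.- 1ℤ ℤ.* + s) ℤ.* + s ≡ ℤ.- + w ℤ.* (+ s ℤ.* 1ℤ)
    cross-multiply = subst (λ s → (+ z ℤ.* 1ℤ ℤ.+ ℤ.- 1ℤ ℤ.* s) ℤ.* s ≡ ℤ.- + w ℤ.* (s ℤ.* 1ℤ))
                           (cong +_ z+w≡s) (identity (+ z) (+ w))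
      where
      identity : ∀ z w → (z ℤ.* 1ℤ ℤ.+ ℤ.- 1ℤ ℤ.* (z ℤ.+ w)) ℤ.* (z ℤ.+ w) ≡ ℤ.- w ℤ.* ((z ℤ.+ w) ℤ.* 1ℤ)
      identity = solve-∀

  ∣p-1∣≡nonzero-fraction : ∀ n → ∣ p n - 1ℚ ∣ ≡ + nonzeros (suc n) / suc n
  ∣p-1∣≡nonzero-fraction n = begin
    ∣ p n - 1ℚ ∣   ≡⟨ cong ∣_∣ (z/s-1≡-w/s {zeroCount n} (zeroCount+nonzeros n)) ⟩
    ∣ - q ∣        ≡⟨ ∣-p∣≡∣p∣ q ⟩
    ∣ q ∣          ≡⟨ 0≤p⇒∣p∣≡p (nonNegative⁻¹ q {{normalize-nonNeg (nonzeros (suc n)) (suc n)}}) ⟩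
    q              ∎
    where
    open ≡-Reasoning
    q = + nonzeros (suc n) / suc n

  w/s<ε : ∀ {ε} → 0ℚ < ε → ∀ {w n} → ↧ₙ ε ℕ.* w ℕ.< suc n → + w / suc n < ε
  w/s<ε {ε@(mkℚ k d-1 _)} (*<* 0<k) {w} {n} dw<s =
    toℚᵘ-cancel-< (ℚᵘ.<-respˡ-≃ (ℚᵘ.≃-sym (toℚᵘ-/ (+ w) n)) (ℚᵘ.*<* w*d<k*s))
    where
    open ℤ.≤-Reasoning
    1≤k : 1ℤ ℤ.≤ k
    1≤k = ℤ.i<j⇒suc[i]≤j (subst (0ℤ ℤ.<_) (ℤ.*-identityʳ k) 0<k)
    w*d<k*s : + w ℤ.* + ↧ₙ ε ℤ.< k ℤ.* + suc n
    w*d<k*s = begin-strict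
      + w ℤ.* + ↧ₙ ε      ≡⟨ ℤ.*-comm (+ w) (+ ↧ₙ ε) ⟩
      + ↧ₙ ε ℤ.* + w      ≡⟨ ℤ.pos-* (↧ₙ ε) w ⟨
      + (↧ₙ ε ℕ.* w)      <⟨ ℤ.+<+ dw<s ⟩
      + suc n             ≡⟨ ℤ.*-identityˡ (+ suc n) ⟨
      1ℤ ℤ.* + suc n      ≤⟨ ℤ.*-monoʳ-≤-nonNeg (+ suc n) 1≤k ⟩
      k ℤ.* + suc n       ∎

open import Data.Nat using (ℕ; suc; _≤_)
open import Data.Nat.Properties using (m≤n⇒m≤1+n)
open import Data.Rational using (ℚ; 0ℚ; 1ℚ; _<_; _-_; ∣_∣; ↧ₙ_)
open import Data.Product using (∃-syntax; _,_)
open import Relation.Binary.PropositionalEquality using (subst; sym)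
open Counting using (nonzeros-sparse)
open Density using (∣p-1∣≡nonzero-fraction; w/s<ε)

proposition2 : (ε : ℚ) → 0ℚ < ε → ∃[ N ] ((n : ℕ) → N ≤ n → ∣ p n - 1ℚ ∣ < ε)
proposition2 ε 0<ε =
  let N , sparse = nonzeros-sparse (↧ₙ ε) in
  N , λ n N≤n → subst (_< ε) (sym (∣p-1∣≡nonzero-fraction n)) (w/s<ε 0<ε (sparse (suc n) (m≤n⇒m≤1+n N≤n)))
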